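{- Let $(\mathbb S,+,\Box,\partial)$ be a monotonic arithmetical semiring and let $p$ be the smallest integer such that $\mathbb S^\Box(p)\neq0$. Then \[ \mathbb S^+(n)-\mathbb S^\Box(n)=\mathbb S^\Box(p)\,\mathbb S^+\!\left(\frac np\right)+O\left(\mathbb S\left(\left\lfloor\frac n{p+1}\right\rfloor+p+1\right)\right). \] Moreover, if axiom $\mathcal G_1^+$ holds then axiom $\mathcal G_1^\Box$ also holds.
   Context: An arithmetical semiring is a tuple $(\mathbb S,+,\Box,\partial)$ where: $(\mathbb S,+)$ is a commutative monoid with identity $\mathbf e_+$ which is free on a set $\mathbb S^+\subseteq\mathbb S\setminus\{\mathbf e_+\}$ (additive primes); $\Box$ is a commutative associative operation distributive over $+$ making $\mathbb S\setminus\{\mathbf e_+\}$ a commutative monoid with identity $\mathbf e_\Box$; $\partial:\mathbb S\to\mathbb R_{\ge0}$ satisfies $\partial(A+B)=\partial(A)+\partial(B)$ and $\partial(A\Box B)=\partial(A)\partial(B)$; $\partial^{ -1}(0)=\{\mathbf e_+\}$; each $\partial^{ -1}(x)$ is finite and is empty unless $x$ is an integer; $(\mathbb S^+,\Box)$ is a free commutative monoid with identity $\mathbf e_\Box$ on a set $\mathbb S^\Box\subseteq\mathbb S^+\setminus\{\mathbf e_\Box\}$ (multiplicative primes); and $\mathbf e_\Box$ is the only additive prime of degree $1$. For real $x\ge0$, $\mathbb S(x)$, $\mathbb S^+(x)$, $\mathbb S^\Box(x)$ denote the numbers of elements of $\mathbb S$, $\mathbb S^+$, $\mathbb S^\Box$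 of degree $x$ (zero if $x$ is not an integer). Monotonic: there is $N$ with $\mathbb S^+(n)\le\mathbb S^+(n+1)$ for all $n\ge N$. The $O$-term means the difference $\mathbb S^+(n)-\mathbb S^\Box(n)-\mathbb S^\Box(p)\mathbb S^+(n/p)$ is bounded in absolute value by $C\,\mathbb S(\lfloor n/(p+1)\rfloor+p+1)$ for a constant $C$ and all large $n$. For nonnegative sequences, $a_n=o(b_n)$ means for all $\epsilon>0$, $a_n\le\epsilon b_n$ for large $n$, and $a_n\sim b_n$ means $a_n-b_n=o(a_n)$. Axiom $\mathcal G_1^+$: $\mathbb S(n)\sim\mathbb S^+(n)$. Axiom $\mathcal G_1^\Box$: $\mathbb S^+(n)\sim\mathbb S^\Box(n)$. -}

module Defs where

open import Data.Nat using (ℕ; zero; suc; _*_; _≤_; _<_)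
import Data.Nat as ℕ
open import Data.Nat.Divisibility using (_∣?_)
open import Data.Nat.DivMod using (_/_)
open import Data.Integer as ℤ using (ℤ; ∣_∣; _-_)
open import Data.List using (List; length; filter; foldr)
open import Data.List.Membership.Propositional using (_∈_)
open import Data.List.Relation.Unary.All using (All)
open import Data.List.Relation.Unary.Unique.Propositional using (Unique)
open import Data.List.Relation.Binary.Permutation.Propositional using (_↭_)
open import Data.Product using (Σ; ∃; _×_)
open import Function.Bundles using (_⇔_)
open import Relation.Nullary using (¬_; yes; no)
open import Relation.Unary using (Decidable)
open import Relation.Binary.PropositionalEquality using (_≡_)

-- An arithmetical semiring (S, +, □, ∂).  The degree map ∂ takes values in ℕ:
-- in the paper ∂ : S → ℝ≥0 with every fibre ∂⁻¹(x) empty unless x is an integer,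
-- so ∂ is exactly an ℕ-valued map.
record ArithSemiring : Set₁ where
  infixl 6 _⊕_
  infixl 7 _□_
  field
    Carrier : Set
    _⊕_     : Carrier → Carrier → Carrier
    _□_     : Carrier → Carrier → Carrier
    e₊      : Carrier
    e□      : Carrier
    ∂       : Carrier → ℕ
    IsAddPrime : Carrier → Set
    addPrime?  : Decidable IsAddPrime
    IsMulPrime : Carrier → Set
    mulPrime?  : Decidable IsMulPrime

    ⊕-assoc    : ∀ a b c → (a ⊕ b) ⊕ c ≡ a ⊕ (b ⊕ c)
    ⊕-comm     : ∀ a b → a ⊕ b ≡ b ⊕ a
    ⊕-identityˡ : ∀ a → e₊ ⊕ a ≡ a
    addPrime≢e₊ : ∀ a → IsAddPrime a → ¬ (a ≡ e₊)
    addFree-exists : ∀ a → Σ (List Carrier) λ xs → All IsAddPrime xs × foldr _⊕_ e₊ xs ≡ a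
    addFree-unique : ∀ xs ys → All IsAddPrime xs → All IsAddPrime ys →
                     foldr _⊕_ e₊ xs ≡ foldr _⊕_ e₊ ys → xs ↭ ys

    □-assoc : ∀ a b c → (a □ b) □ c ≡ a □ (b □ c)
    □-comm  : ∀ a b → a □ b ≡ b □ a
    □-distrib : ∀ a b c → a □ (b ⊕ c) ≡ a □ b ⊕ a □ c
    e□≢e₊ : ¬ (e□ ≡ e₊)
    □-closed : ∀ a b → ¬ (a ≡ e₊) → ¬ (b ≡ e₊) → ¬ (a □ b ≡ e₊)
    □-identityˡ : ∀ a → ¬ (a ≡ e₊) → e□ □ a ≡ a

    ∂-⊕ : ∀ a b → ∂ (a ⊕ b) ≡ ∂ a ℕ.+ ∂ b
    ∂-□ : ∀ a b → ∂ (a □ b) ≡ ∂ a * ∂ b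
    ∂-zero : ∀ a → ∂ a ≡ 0 ⇔ a ≡ e₊
    -- finite fibres: an enumeration without repetition of ∂⁻¹(n)
    fibre : ℕ → List Carrier
    fibre-unique : ∀ n → Unique (fibre n)
    fibre-complete : ∀ n a → a ∈ fibre n ⇔ ∂ a ≡ n

    e□-addPrime : IsAddPrime e□
    addPrime-□ : ∀ a b → IsAddPrime a → IsAddPrime b → IsAddPrime (a □ b)
    mulPrime-addPrime : ∀ a → IsMulPrime a → IsAddPrime a
    mulPrime≢e□ : ∀ a → IsMulPrime a → ¬ (a ≡ e□)
    mulFree-exists : ∀ a → IsAddPrime a →
                     Σ (List Carrier) λ xs → All IsMulPrime xs × foldr _□_ e□ xs ≡ a
    mulFree-unique : ∀ xs ys → All IsMulPrime xs → All IsMulPrime ys →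
                     foldr _□_ e□ xs ≡ foldr _□_ e□ ys → xs ↭ ys

    deg1-addPrime : ∀ a → IsAddPrime a → ∂ a ≡ 1 → a ≡ e□

  S : ℕ → ℕ
  S n = length (fibre n)

  S⁺ : ℕ → ℕ
  S⁺ n = length (filter addPrime? (fibre n))

  S□ : ℕ → ℕ
  S□ n = length (filter mulPrime? (fibre n))

open ArithSemiring public

-- f (n / d) for a counting function f, which is 0 unless n / d is an integer
-- (d = 0 never occurs in use; it is given value 0).
atQuotient : (ℕ → ℕ) → ℕ → ℕ → ℕ
atQuotient f n zero = 0
atQuotient f n (suc d) with suc d ∣? n
... | yes _ = f (n / suc d)
... | no  _ = 0

Monotonic : ArithSemiring → Set
Monotonic 𝕊 = ∃ λ N → ∀ n → N ≤ n → S⁺ 𝕊 n ≤ S⁺ 𝕊 (suc n)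

-- a ~ b for nonnegative sequences: for every ε > 0, |a n - b n| ≤ ε a n for all large n.
-- ε ranges over 1/(k+1), which is cofinal among positive reals (equivalent definition).
_∼_ : (ℕ → ℕ) → (ℕ → ℕ) → Set
a ∼ b = ∀ k → ∃ λ N → ∀ n → N ≤ n →
          suc k * ∣ ℤ.+ (a n) - ℤ.+ (b n) ∣ ≤ a n

G₁⁺ : ArithSemiring → Set
G₁⁺ 𝕊 = S 𝕊 ∼ S⁺ 𝕊

G₁□ : ArithSemiring → Set
G₁□ 𝕊 = S⁺ 𝕊 ∼ S□ 𝕊

IsLeastMulPrimeDegree : ArithSemiring → ℕ → Set
IsLeastMulPrimeDegree 𝕊 p = ¬ (S□ 𝕊 p ≡ 0) × (∀ m → m < p → S□ 𝕊 m ≡ 0)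

MainEstimate : ArithSemiring → ℕ → Set
MainEstimate 𝕊 p = ∃ λ C → ∃ λ N → ∀ n → N ≤ n →
  ∣ ℤ.+ (S⁺ 𝕊 n) - ℤ.+ (S□ 𝕊 n) - ℤ.+ (S□ 𝕊 p * atQuotient (S⁺ 𝕊) n p) ∣
    ≤ C * S 𝕊 (n / suc p ℕ.+ p ℕ.+ 1)

-- The composites of degree n, i.e. the additive primes that are not multiplicative primes, number
-- 𝕊⁺(n) − 𝕊□(n). A composite with a prime factor q of the least degree p is q □ b with b an additive
-- prime of degree n/p; conversely q □ b is composite, and q and b are read off its factorisation,
-- whenever b has no prime factor of degree p. The exceptional b are again such products, so both
-- errors are at most 𝕊□(p)² 𝕊⁺(n/p²). A composite without a factor of degree p is q □ b with
-- ∂q, ∂b ≥ p + 1, hence ∂q + ∂b ≤ ⌊n/(p+1)⌋ + p + 1, and it is recovered from the element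
-- q + b + e□ + ⋯ + e□ of that degree by multiplying out its additive prime factors other than e□.
-- The same padding by e□ injects the additive primes of any degree j < n into the non-primes of
-- degree n; this turns 𝕊(n) ∼ 𝕊⁺(n) into 𝕊⁺(n) ∼ 𝕊□(n).

module Submission where

open import Defs using (ArithSemiring; module ArithSemiring; atQuotient; Monotonic; G₁⁺; G₁□; IsLeastMulPrimeDegree; MainEstimate)
open import Data.Nat using (ℕ; zero; suc; _+_; _*_; _∸_; _≤_; _<_; _≟_; _⊔_; z≤n; s≤s; NonZero; >-nonZero; ≢-nonZero)
open import Data.Nat.Properties
open import Data.Nat.Solver using (module +-*-Solver)
open import Data.Nat.Divisibility using (_∣_; _∣?_; divides)
open import Data.Nat.DivMod using (_/_; m*n/n≡m; m*[n/m]≡n; /-monoˡ-≤; /-monoʳ-≤; m/n/o≡m/[n*o]; m/n<m; m/n*n≤m)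
import Data.Integer as ℤ
import Data.Integer.Properties as ℤ
open import Data.List using (List; []; _∷_; _++_; [_]; length; filter; foldr; map; replicate; cartesianProduct)
open import Data.Nat.ListAction using (sum)
open import Data.List.Properties using (length-++; length-map; length-replicate; filter-accept; filter-reject; filter-all; filter-none; filter-++; ++-identityʳ)
open import Data.List.Membership.Propositional using (_∈_; find)
open import Data.List.Membership.Propositional.Properties using (∈-∃++; ∈-map⁺; ∈-filter⁺; ∈-filter⁻; ∈-cartesianProduct⁺; ∈-cartesianProduct⁻)
open import Data.List.Relation.Binary.Subset.Propositional using (_⊆_)
open import Data.List.Relation.Unary.All as All using (All; []; _∷_)
open import Data.List.Relation.Unary.All.Properties using (¬Any⇒All¬; ++⁺; replicate⁺)
open import Data.List.Relation.Unary.Any using (Any; here; there; any?)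
open import Data.List.Relation.Unary.Unique.Propositional using (Unique)
import Data.List.Relation.Unary.Unique.Propositional.Properties as Unique
open import Data.List.Relation.Unary.AllPairs using (_∷_)
open import Data.List.Relation.Binary.Permutation.Propositional as ↭ using (_↭_)
open import Data.List.Relation.Binary.Permutation.Propositional.Properties using (↭-length; shift; All-resp-↭; filter-↭)
open import Data.Product using (_×_; _,_; proj₁; proj₂; ∃; ∃₂; uncurry)
open import Data.Sum using (inj₁; inj₂)
open import Data.Empty using (⊥)
open import Function using (_∘_)
open import Level using (0ℓ)
open import Function.Bundles using (Equivalence)
open import Relation.Nullary using (¬_; Dec; yes; no; ¬?; contradiction)
open import Relation.Unary using (Pred; Decidable)
open import Relation.Unary.Properties using (∁?)
open import Relation.Binary.PropositionalEquality using (_≡_; _≢_; refl; sym; trans; cong; cong₂; subst; subst₂; module ≡-Reasoning)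

module _ {A : Set} where

  ∈-++-∷⁻ : ∀ {x y : A} as bs → y ≢ x → y ∈ as ++ x ∷ bs → y ∈ as ++ bs
  ∈-++-∷⁻ []       bs y≢x (here y≡x) = contradiction y≡x y≢x
  ∈-++-∷⁻ []       bs y≢x (there y∈) = y∈
  ∈-++-∷⁻ (a ∷ as) bs y≢x (here y≡a) = here y≡a
  ∈-++-∷⁻ (a ∷ as) bs y≢x (there y∈) = there (∈-++-∷⁻ as bs y≢x y∈)

  Unique⇒length-≤ : ∀ {xs ys : List A} → Unique xs → xs ⊆ ys → length xs ≤ length ys
  Unique⇒length-≤ {[]}     _            _   = z≤n
  Unique⇒length-≤ {x ∷ xs} (x∉xs ∷ uxs) ⊆ys with ∈-∃++ (⊆ys (here refl))
  ... | as , bs , refl = begin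
    suc (length xs)                   ≤⟨ s≤s (Unique⇒length-≤ uxs xs⊆asbs) ⟩
    suc (length (as ++ bs))           ≡⟨ cong suc (length-++ as) ⟩
    suc (length as + length bs)       ≡⟨ +-suc (length as) (length bs) ⟨
    length as + length (x ∷ bs)       ≡⟨ length-++ as ⟨
    length (as ++ x ∷ bs)             ∎
    where
    open ≤-Reasoning
    xs⊆asbs : xs ⊆ as ++ bs
    xs⊆asbs y∈ = ∈-++-∷⁻ as bs (λ y≡x → All.lookup x∉xs y∈ (sym y≡x)) (⊆ys (there y∈))

  length-filter-∁ : ∀ {P : Pred A 0ℓ} (P? : Decidable P) xs →
                    length (filter P? xs) + length (filter (∁? P?) xs) ≡ length xs
  length-filter-∁ P? []       = refl
  length-filter-∁ P? (x ∷ xs) with P? x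
  ... | yes _ = cong suc (length-filter-∁ P? xs)
  ... | no  _ = trans (+-suc _ _) (cong suc (length-filter-∁ P? xs))

  ∈⇒0<length : ∀ {x : A} {xs} → x ∈ xs → 0 < length xs
  ∈⇒0<length {xs = _ ∷ _} _ = s≤s z≤n

module _ {A B : Set} where

  Unique⇒length-≤-map : ∀ (f : A → B) {xs ys} → Unique xs → xs ⊆ map f ys → length xs ≤ length ys
  Unique⇒length-≤-map f {ys = ys} uxs ⊆fys = ≤-trans (Unique⇒length-≤ uxs ⊆fys) (≤-reflexive (length-map f ys))

  length-cartesianProduct : ∀ (xs : List A) (ys : List B) →
                            length (cartesianProduct xs ys) ≡ length xs * length ys
  length-cartesianProduct []       ys = refl
  length-cartesianProduct (x ∷ xs) ys = begin
    length (map (x ,_) ys ++ cartesianProduct xs ys)          ≡⟨ length-++ (map (x ,_) ys) ⟩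
    length (map (x ,_) ys) + length (cartesianProduct xs ys)  ≡⟨ cong₂ _+_ (length-map (x ,_) ys) (length-cartesianProduct xs ys) ⟩
    length ys + length xs * length ys                         ∎
    where open ≡-Reasoning

m+n≤m*n/o+o : ∀ {m n} o .{{_ : NonZero o}} → o ≤ m → o ≤ n → m + n ≤ m * n / o + o
m+n≤m*n/o+o {m} {n} o o≤m o≤n with m ∸ o | m+[n∸m]≡n o≤m | n ∸ o | m+[n∸m]≡n o≤n
... | u | refl | v | refl = begin
  (o + u) + (o + v)             ≡⟨ sum-identity o u v ⟩
  (o + u + v) + o               ≤⟨ +-monoˡ-≤ o (begin
    o + u + v                       ≡⟨ m*n/n≡m (o + u + v) o ⟨
    (o + u + v) * o / o             ≤⟨ /-monoˡ-≤ o (m≤m+n _ (u * v)) ⟩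
    ((o + u + v) * o + u * v) / o   ≡⟨ cong (_/ o) (product-identity o u v) ⟨
    (o + u) * (o + v) / o           ∎) ⟩
  (o + u) * (o + v) / o + o     ∎
  where
  open ≤-Reasoning
  open +-*-Solver using (solve; _:+_; _:*_; _:=_)
  sum-identity : ∀ o u v → (o + u) + (o + v) ≡ (o + u + v) + o
  sum-identity = solve 3 (λ o u v → (o :+ u) :+ (o :+ v) := (o :+ u :+ v) :+ o) refl
  product-identity : ∀ o u v → (o + u) * (o + v) ≡ (o + u + v) * o + u * v
  product-identity = solve 3 (λ o u v → (o :+ u) :* (o :+ v) := (o :+ u :+ v) :* o :+ u :* v) refl

module _ (f : ℕ → ℕ) (n d : ℕ) where

  atQuotient-∣ : suc d ∣ n → atQuotient f n (suc d) ≡ f (n / suc d)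
  atQuotient-∣ d∣n with suc d ∣? n
  ... | yes _   = refl
  ... | no  d∤n = contradiction d∣n d∤n

  atQuotient-∤ : ¬ suc d ∣ n → atQuotient f n (suc d) ≡ 0
  atQuotient-∤ d∤n with suc d ∣? n
  ... | yes d∣n = contradiction d∣n d∤n
  ... | no  _   = refl

  atQuotient-≤ : ∀ {b} → (suc d ∣ n → f (n / suc d) ≤ b) → atQuotient f n (suc d) ≤ b
  atQuotient-≤ bound with suc d ∣? n
  ... | yes d∣n = bound d∣n
  ... | no  _   = z≤n

+m-+n≡+[m∸n] : ∀ {m n} → n ≤ m → ℤ.+ m ℤ.- ℤ.+ n ≡ ℤ.+ (m ∸ n)
+m-+n≡+[m∸n] {m} {n} n≤m = trans (ℤ.m-n≡m⊖n m n) (ℤ.⊖-≥ n≤m)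

∣+m-+n∣≤x+y : ∀ {m n x y} → m ≤ n + x → n ≤ m + y → ℤ.∣ ℤ.+ m ℤ.- ℤ.+ n ∣ ≤ x + y
∣+m-+n∣≤x+y {m} {n} {x} {y} m≤n+x n≤m+y with ≤-total m n
... | inj₂ n≤m rewrite +m-+n≡+[m∸n] n≤m = ≤-trans (m≤n+o⇒m∸n≤o m n m≤n+x) (m≤m+n x y)
... | inj₁ m≤n rewrite ℤ.∣i-j∣≡∣j-i∣ (ℤ.+ m) (ℤ.+ n) | +m-+n≡+[m∸n] m≤n =
  ≤-trans (m≤n+o⇒m∸n≤o n m n≤m+y) (m≤n+m y x)

2*[m∸n]≤m⇒m≤2*n : ∀ {m n} → 2 * (m ∸ n) ≤ m → m ≤ 2 * n
2*[m∸n]≤m⇒m≤2*n {m} {n} le = begin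
  m              ≤⟨ m≤n+m∸n m n ⟩
  n + (m ∸ n)    ≤⟨ +-monoʳ-≤ n m∸n≤n ⟩
  n + n          ≡⟨ cong (n +_) (+-identityʳ n) ⟨
  2 * n          ∎
  where
  open ≤-Reasoning
  m∸n≤n : m ∸ n ≤ n
  m∸n≤n = +-cancelʳ-≤ (m ∸ n) (m ∸ n) n (begin
    (m ∸ n) + (m ∸ n)       ≡⟨ cong ((m ∸ n) +_) (+-identityʳ (m ∸ n)) ⟨
    2 * (m ∸ n)             ≤⟨ le ⟩
    m                       ≤⟨ m≤n+m∸n m n ⟩
    n + (m ∸ n)             ∎)

Eventually : (ℕ → Set) → Set
Eventually P = ∃ λ N → ∀ n → N ≤ n → P n

module _ {P Q : ℕ → Set} where

  eventually-map : (∀ {n} → P n → Q n) → Eventually P → Eventually Q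
  eventually-map P⇒Q (N , P≥N) = N , λ n N≤n → P⇒Q (P≥N n N≤n)

  eventually-× : Eventually P → Eventually Q → Eventually (λ n → P n × Q n)
  eventually-× (M , P≥M) (N , Q≥N) = M ⊔ N , λ n M⊔N≤n → P≥M n (m⊔n≤o⇒m≤o M N M⊔N≤n) , Q≥N n (m⊔n≤o⇒n≤o M N M⊔N≤n)

eventually-≥ : ∀ M → Eventually (M ≤_)
eventually-≥ M = M , λ _ M≤n → M≤n

eventually-∘ : ∀ {P} (f : ℕ → ℕ) → (∀ M → Eventually (λ n → M ≤ f n)) → Eventually P → Eventually (P ∘ f)
eventually-∘ f f→∞ (N , P≥N) = let M , f≥N = f→∞ N in M , λ n M≤n → P≥N (f n) (f≥N n M≤n)

module Properties (𝕊 : ArithSemiring) where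
  open ArithSemiring 𝕊

  ∑ ∏ : List Carrier → Carrier
  ∑ = foldr _⊕_ e₊
  ∏ = foldr _□_ e□

  addPrimes mulPrimes : ℕ → List Carrier
  addPrimes n = filter addPrime? (fibre n)
  mulPrimes n = filter mulPrime? (fibre n)

  ∈-fibre⁺ : ∀ {a n} → ∂ a ≡ n → a ∈ fibre n
  ∈-fibre⁺ {a} {n} = Equivalence.from (fibre-complete n a)

  ∈-fibre⁻ : ∀ {a n} → a ∈ fibre n → ∂ a ≡ n
  ∈-fibre⁻ {a} {n} = Equivalence.to (fibre-complete n a)

  ∈-addPrimes⁺ : ∀ {a n} → IsAddPrime a → ∂ a ≡ n → a ∈ addPrimes n
  ∈-addPrimes⁺ ap ∂a≡n = ∈-filter⁺ addPrime? (∈-fibre⁺ ∂a≡n) ap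

  ∈-addPrimes⁻ : ∀ {a n} → a ∈ addPrimes n → IsAddPrime a × ∂ a ≡ n
  ∈-addPrimes⁻ {n = n} a∈ = let a∈fibre , ap = ∈-filter⁻ addPrime? {xs = fibre n} a∈ in ap , ∈-fibre⁻ a∈fibre

  ∈-mulPrimes⁺ : ∀ {a n} → IsMulPrime a → ∂ a ≡ n → a ∈ mulPrimes n
  ∈-mulPrimes⁺ mp ∂a≡n = ∈-filter⁺ mulPrime? (∈-fibre⁺ ∂a≡n) mp

  ∈-mulPrimes⁻ : ∀ {a n} → a ∈ mulPrimes n → IsMulPrime a × ∂ a ≡ n
  ∈-mulPrimes⁻ {n = n} a∈ = let a∈fibre , mp = ∈-filter⁻ mulPrime? {xs = fibre n} a∈ in mp , ∈-fibre⁻ a∈fibre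

  Unique-addPrimes : ∀ n → Unique (addPrimes n)
  Unique-addPrimes n = Unique.filter⁺ addPrime? (fibre-unique n)

  Unique-mulPrimes : ∀ n → Unique (mulPrimes n)
  Unique-mulPrimes n = Unique.filter⁺ mulPrime? (fibre-unique n)

  ⊕-identityʳ : ∀ a → a ⊕ e₊ ≡ a
  ⊕-identityʳ a = trans (⊕-comm a e₊) (⊕-identityˡ a)

  □-identityʳ : ∀ {a} → a ≢ e₊ → a □ e□ ≡ a
  □-identityʳ {a} a≢e₊ = trans (□-comm a e□) (□-identityˡ a a≢e₊)

  ∂e₊≡0 : ∂ e₊ ≡ 0
  ∂e₊≡0 = Equivalence.from (∂-zero e₊) refl

  ∂≡0⇒≡e₊ : ∀ {a} → ∂ a ≡ 0 → a ≡ e₊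
  ∂≡0⇒≡e₊ {a} = Equivalence.to (∂-zero a)

  ∂e□≡1 : ∂ e□ ≡ 1
  ∂e□≡1 = *-cancelˡ-≡ (∂ e□) 1 (∂ e□) {{≢-nonZero (e□≢e₊ ∘ ∂≡0⇒≡e₊)}} (begin
    ∂ e□ * ∂ e□    ≡⟨ ∂-□ e□ e□ ⟨
    ∂ (e□ □ e□)    ≡⟨ cong ∂ (□-identityˡ e□ e□≢e₊) ⟩
    ∂ e□           ≡⟨ *-identityʳ (∂ e□) ⟨
    ∂ e□ * 1       ∎)
    where open ≡-Reasoning

  addPrime⇒≢e₊ : ∀ {a} → IsAddPrime a → a ≢ e₊
  addPrime⇒≢e₊ {a} = addPrime≢e₊ a

  addPrime⇒0<∂ : ∀ {a} → IsAddPrime a → 0 < ∂ a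
  addPrime⇒0<∂ ap = n≢0⇒n>0 (addPrime⇒≢e₊ ap ∘ ∂≡0⇒≡e₊)

  mulPrime⇒2≤∂ : ∀ {a} → IsMulPrime a → 2 ≤ ∂ a
  mulPrime⇒2≤∂ {a} mp = ≤∧≢⇒< (addPrime⇒0<∂ ap) (λ 1≡∂a → mulPrime≢e□ a mp (deg1-addPrime a ap (sym 1≡∂a)))
    where ap = mulPrime-addPrime a mp

  2≤∂⇒≢e□ : ∀ {a} → 2 ≤ ∂ a → a ≢ e□
  2≤∂⇒≢e□ 2≤∂a a≡e□ = <⇒≱ 2≤∂a (≤-reflexive (trans (cong ∂ a≡e□) ∂e□≡1))

  mulPrimes⇒addPrimes : ∀ {xs} → All IsMulPrime xs → All IsAddPrime xs
  mulPrimes⇒addPrimes = All.map (mulPrime-addPrime _)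

  S□[<2]≡0 : ∀ {n} → n < 2 → S□ n ≡ 0
  S□[<2]≡0 {n} n<2 = cong length (filter-none mulPrime? (All.tabulate λ a∈ mp →
    <⇒≱ n<2 (subst (2 ≤_) (∈-fibre⁻ a∈) (mulPrime⇒2≤∂ mp))))

  ∏-↭ : ∀ {xs ys} → xs ↭ ys → ∏ xs ≡ ∏ ys
  ∏-↭ ↭.refl          = refl
  ∏-↭ (↭.prep x ρ)    = cong (x □_) (∏-↭ ρ)
  ∏-↭ (↭.swap x y ρ)  = begin
    x □ (y □ _)   ≡⟨ □-assoc x y _ ⟨
    (x □ y) □ _   ≡⟨ cong₂ _□_ (□-comm x y) (∏-↭ ρ) ⟩
    (y □ x) □ _   ≡⟨ □-assoc y x _ ⟩
    y □ (x □ _)   ∎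
    where open ≡-Reasoning
  ∏-↭ (↭.trans ρ σ)   = trans (∏-↭ ρ) (∏-↭ σ)

  addPrime-∏ : ∀ {xs} → All IsAddPrime xs → IsAddPrime (∏ xs)
  addPrime-∏ []          = e□-addPrime
  addPrime-∏ (ax ∷ axs)  = addPrime-□ _ _ ax (addPrime-∏ axs)

  padded : List Carrier → ℕ → Carrier
  padded xs j = ∑ (xs ++ replicate j e□)

  ∂-padded : ∀ xs j → ∂ (padded xs j) ≡ sum (map ∂ xs) + j
  ∂-padded []       zero    = ∂e₊≡0
  ∂-padded []       (suc j) = trans (∂-⊕ e□ _) (cong₂ _+_ ∂e□≡1 (∂-padded [] j))
  ∂-padded (x ∷ xs) j       = trans (∂-⊕ x _) (trans (cong (∂ x +_) (∂-padded xs j)) (sym (+-assoc (∂ x) _ j)))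

  ∑-¬addPrime : ∀ {ys} → All IsAddPrime ys → 2 ≤ length ys → ¬ IsAddPrime (∑ ys)
  ∑-¬addPrime {ys} ays 2≤ys ap = <⇒≢ 2≤ys (↭-length (addFree-unique [ ∑ ys ] ys (ap ∷ []) ays (⊕-identityʳ (∑ ys))))

  addFactors : Carrier → List Carrier
  addFactors a = proj₁ (addFree-exists a)

  addFactors-∑ : ∀ {ys} → All IsAddPrime ys → addFactors (∑ ys) ↭ ys
  addFactors-∑ {ys} ays = let afs , ∑afs≡∑ys = proj₂ (addFree-exists (∑ ys)) in addFree-unique _ ys afs ays ∑afs≡∑ys

  ∂≢1? : Decidable (λ x → ∂ x ≢ 1)
  ∂≢1? x = ¬? (∂ x ≟ 1)

  collapse : Carrier → Carrier
  collapse a = ∏ (filter ∂≢1? (addFactors a))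

  collapse-padded : ∀ {xs} j → All IsAddPrime xs → All (λ x → ∂ x ≢ 1) xs → collapse (padded xs j) ≡ ∏ xs
  collapse-padded {xs} j axs xs≢1 = begin
    collapse (padded xs j)                         ≡⟨ ∏-↭ (filter-↭ ∂≢1? (addFactors-∑ (++⁺ axs (replicate⁺ j e□-addPrime)))) ⟩
    ∏ (filter ∂≢1? (xs ++ replicate j e□))         ≡⟨ cong ∏ (filter-++ ∂≢1? xs (replicate j e□)) ⟩
    ∏ (filter ∂≢1? xs ++ filter ∂≢1? (replicate j e□))
      ≡⟨ cong₂ (λ us vs → ∏ (us ++ vs)) (filter-all ∂≢1? xs≢1) (filter-none ∂≢1? (replicate⁺ j (λ ∂e□≢1 → ∂e□≢1 ∂e□≡1))) ⟩
    ∏ (xs ++ [])                                    ≡⟨ cong ∏ (++-identityʳ xs) ⟩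
    ∏ xs                                            ∎
    where open ≡-Reasoning

  collapse-padded-addPrime : ∀ {x} j → IsAddPrime x → collapse (padded [ x ] j) ≡ x
  collapse-padded-addPrime {x} j ax with ∂ x ≟ 1
  ... | yes ∂x≡1 rewrite deg1-addPrime x ax ∂x≡1 = collapse-padded (suc j) [] []
  ... | no  ∂x≢1 = trans (collapse-padded j (ax ∷ []) (∂x≢1 ∷ [])) (□-identityʳ (addPrime⇒≢e₊ ax))

  S⁺≤S : ∀ n → S⁺ n ≤ S n
  S⁺≤S n = subst (S⁺ n ≤_) (length-filter-∁ addPrime? (fibre n)) (m≤m+n (S⁺ n) _)

  S⁺-≤-S∸S⁺ : ∀ {j n} → j < n → S⁺ j ≤ S n ∸ S⁺ n
  S⁺-≤-S∸S⁺ {j} {n} j<n = begin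
    S⁺ j                                ≤⟨ Unique⇒length-≤-map collapse (Unique-addPrimes j) ⊆collapse ⟩
    length nonPrimes                    ≡⟨ m+n∸m≡n (S⁺ n) (length nonPrimes) ⟨
    S⁺ n + length nonPrimes ∸ S⁺ n      ≡⟨ cong (_∸ S⁺ n) (length-filter-∁ addPrime? (fibre n)) ⟩
    S n ∸ S⁺ n                          ∎
    where
    open ≤-Reasoning
    nonPrimes : List Carrier
    nonPrimes = filter (∁? addPrime?) (fibre n)
    ⊆collapse : addPrimes j ⊆ map collapse nonPrimes
    ⊆collapse {x} x∈ = subst (_∈ map collapse nonPrimes) (collapse-padded-addPrime (n ∸ j) ax)
      (∈-map⁺ collapse (∈-filter⁺ (∁? addPrime?) (∈-fibre⁺ ∂padded≡n)
                                  (∑-¬addPrime (ax ∷ replicate⁺ (n ∸ j) e□-addPrime) 2≤length)))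
      where
      ax = proj₁ (∈-addPrimes⁻ x∈)
      ∂padded≡n : ∂ (padded [ x ] (n ∸ j)) ≡ n
      ∂padded≡n = trans (∂-padded [ x ] (n ∸ j))
                        (trans (cong (_+ (n ∸ j)) (trans (+-identityʳ (∂ x)) (proj₂ (∈-addPrimes⁻ x∈))))
                               (m+[n∸m]≡n (<⇒≤ j<n)))
      2≤length : 2 ≤ length (x ∷ replicate (n ∸ j) e□)
      2≤length = s≤s (subst (1 ≤_) (sym (length-replicate (n ∸ j))) (m<n⇒0<n∸m j<n))

  S⁺-≤-S : ∀ {j n} → j ≤ n → S⁺ j ≤ S n
  S⁺-≤-S {j} {n} j≤n with m≤n⇒m<n∨m≡n j≤n
  ... | inj₁ j<n  = ≤-trans (S⁺-≤-S∸S⁺ j<n) (m∸n≤m (S n) (S⁺ n))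
  ... | inj₂ refl = S⁺≤S n

  -- Non-primes get the empty factorisation.
  factors : Carrier → List Carrier
  factors a with addPrime? a
  ... | yes ap = proj₁ (mulFree-exists a ap)
  ... | no  _  = []

  factors-mulPrime : ∀ {a} → IsAddPrime a → All IsMulPrime (factors a)
  factors-mulPrime {a} ap with addPrime? a
  ... | yes ap′ = proj₁ (proj₂ (mulFree-exists a ap′))
  ... | no ¬ap  = contradiction ap ¬ap

  ∏-factors : ∀ {a} → IsAddPrime a → ∏ (factors a) ≡ a
  ∏-factors {a} ap with addPrime? a
  ... | yes ap′ = proj₂ (proj₂ (mulFree-exists a ap′))
  ... | no ¬ap  = contradiction ap ¬ap

  factors-unique : ∀ {a xs} → IsAddPrime a → All IsMulPrime xs → ∏ xs ≡ a → factors a ↭ xs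
  factors-unique ap mxs ∏xs≡a = mulFree-unique _ _ (factors-mulPrime ap) mxs (trans (∏-factors ap) (sym ∏xs≡a))

  composites : ℕ → List Carrier
  composites n = filter (∁? mulPrime?) (addPrimes n)

  Unique-composites : ∀ n → Unique (composites n)
  Unique-composites n = Unique.filter⁺ (∁? mulPrime?) (Unique-addPrimes n)

  ∈-composites⁻ : ∀ {a n} → a ∈ composites n → IsAddPrime a × ¬ IsMulPrime a × ∂ a ≡ n
  ∈-composites⁻ {n = n} a∈ =
    let a∈addPrimes , ¬mp = ∈-filter⁻ (∁? mulPrime?) {xs = addPrimes n} a∈
        ap , ∂a≡n = ∈-addPrimes⁻ a∈addPrimes
    in ap , ¬mp , ∂a≡n

  S⁺≡S□+composites : ∀ n → S⁺ n ≡ S□ n + length (composites n)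
  S⁺≡S□+composites n = trans (sym (length-filter-∁ mulPrime? (addPrimes n)))
                             (cong (λ xs → length xs + length (composites n)) (mulPrimes-addPrimes (fibre n)))
    where
    mulPrimes-addPrimes : ∀ xs → filter mulPrime? (filter addPrime? xs) ≡ filter mulPrime? xs
    mulPrimes-addPrimes []       = refl
    mulPrimes-addPrimes (x ∷ xs) with addPrime? x
    ... | no ¬ap = trans (mulPrimes-addPrimes xs) (sym (filter-reject mulPrime? (¬ap ∘ mulPrime-addPrime x)))
    ... | yes _ with mulPrime? x
    ...   | yes _ = cong (x ∷_) (mulPrimes-addPrimes xs)
    ...   | no  _ = mulPrimes-addPrimes xs

  ∂≡? : ∀ d → Decidable (λ x → ∂ x ≡ d)
  ∂≡? d x = ∂ x ≟ d

  HasFactorOfDegree : ℕ → Carrier → Set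
  HasFactorOfDegree d a = Any (λ x → ∂ x ≡ d) (factors a)

  hasFactorOfDegree? : ∀ d → Decidable (HasFactorOfDegree d)
  hasFactorOfDegree? d a = any? (∂≡? d) (factors a)

  products : ℕ → ℕ → List Carrier
  products d k = map (uncurry _□_) (cartesianProduct (mulPrimes d) (addPrimes k))

  length-products : ∀ d k → length (products d k) ≡ S□ d * S⁺ k
  length-products d k = trans (length-map (uncurry _□_) (cartesianProduct (mulPrimes d) (addPrimes k)))
                              (length-cartesianProduct (mulPrimes d) (addPrimes k))

  hasFactorOfDegree⇒∈products : ∀ {d a} .{{_ : NonZero d}} → IsAddPrime a → HasFactorOfDegree d a →
                                d ∣ ∂ a × a ∈ products d (∂ a / d)
  hasFactorOfDegree⇒∈products {d} {a} ap hasFactor with find hasFactor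
  ... | x , x∈ , ∂x≡d with ∈-∃++ x∈
  ... | as , bs , factors≡ = divides (∂ b) ∂a≡∂b*d , subst (_∈ products d (∂ a / d)) (sym a≡x□b) x□b∈
    where
    open ≡-Reasoning
    factors↭ : factors a ↭ x ∷ as ++ bs
    factors↭ = subst (_↭ x ∷ as ++ bs) (sym factors≡) (shift x as bs)
    mx∷mrest : All IsMulPrime (x ∷ as ++ bs)
    mx∷mrest = All-resp-↭ factors↭ (factors-mulPrime ap)
    b : Carrier
    b = ∏ (as ++ bs)
    a≡x□b : a ≡ x □ b
    a≡x□b = trans (sym (∏-factors ap)) (∏-↭ factors↭)
    ∂a≡∂b*d : ∂ a ≡ ∂ b * d
    ∂a≡∂b*d = begin
      ∂ a        ≡⟨ cong ∂ a≡x□b ⟩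
      ∂ (x □ b)  ≡⟨ ∂-□ x b ⟩
      ∂ x * ∂ b  ≡⟨ cong (_* ∂ b) ∂x≡d ⟩
      d * ∂ b    ≡⟨ *-comm d (∂ b) ⟩
      ∂ b * d    ∎
    x□b∈ : x □ b ∈ products d (∂ a / d)
    x□b∈ = ∈-map⁺ (uncurry _□_) (∈-cartesianProduct⁺
      (∈-mulPrimes⁺ (All.head mx∷mrest) ∂x≡d)
      (∈-addPrimes⁺ (addPrime-∏ (mulPrimes⇒addPrimes (All.tail mx∷mrest)))
                    (sym (trans (cong (_/ d) ∂a≡∂b*d) (m*n/n≡m (∂ b) d)))))

  length-≤-hasFactorOfDegree : ∀ d k {L} → Unique L →
    (∀ {a} → a ∈ L → a ∈ addPrimes k × HasFactorOfDegree (suc d) a) →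
    length L ≤ S□ (suc d) * atQuotient S⁺ k (suc d)
  length-≤-hasFactorOfDegree d k {[]}    _  _  = z≤n
  length-≤-hasFactorOfDegree d k {a ∷ L} uL ⊆L = begin
    length (a ∷ L)                          ≤⟨ Unique⇒length-≤ uL ⊆products ⟩
    length (products (suc d) (k / suc d))   ≡⟨ length-products (suc d) (k / suc d) ⟩
    S□ (suc d) * S⁺ (k / suc d)             ≡⟨ cong (S□ (suc d) *_) (atQuotient-∣ S⁺ k d d∣k) ⟨
    S□ (suc d) * atQuotient S⁺ k (suc d)    ∎
    where
    open ≤-Reasoning
    ∈products : ∀ {a′} → a′ ∈ a ∷ L → suc d ∣ k × a′ ∈ products (suc d) (k / suc d)
    ∈products a′∈ with ⊆L a′∈
    ... | a′∈addPrimes , hasFactor with ∈-addPrimes⁻ a′∈addPrimes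
    ...   | ap , refl = hasFactorOfDegree⇒∈products ap hasFactor
    d∣k = proj₁ (∈products (here refl))
    ⊆products : a ∷ L ⊆ products (suc d) (k / suc d)
    ⊆products = proj₂ ∘ ∈products

  split : ℕ → Carrier → Carrier × Carrier
  split d c = ∏ (filter (∂≡? d) (factors c)) , ∏ (filter (∁? (∂≡? d)) (factors c))

  split-□ : ∀ {d q b} → IsMulPrime q → ∂ q ≡ d → IsAddPrime b → ¬ HasFactorOfDegree d b → split d (q □ b) ≡ (q , b)
  split-□ {d} {q} {b} mq ∂q≡d ab ¬hasFactor = cong₂ _,_ factor-of-degree-d other-factors
    where
    open ≡-Reasoning
    factors↭ : factors (q □ b) ↭ q ∷ factors b
    factors↭ = factors-unique (addPrime-□ q b (mulPrime-addPrime q mq) ab) (mq ∷ factors-mulPrime ab)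
                              (cong (q □_) (∏-factors ab))
    others : All (λ x → ¬ ∂ x ≡ d) (factors b)
    others = ¬Any⇒All¬ (factors b) ¬hasFactor
    factor-of-degree-d : ∏ (filter (∂≡? d) (factors (q □ b))) ≡ q
    factor-of-degree-d = begin
      ∏ (filter (∂≡? d) (factors (q □ b)))   ≡⟨ ∏-↭ (filter-↭ (∂≡? d) factors↭) ⟩
      ∏ (filter (∂≡? d) (q ∷ factors b))     ≡⟨ cong ∏ (filter-accept (∂≡? d) ∂q≡d) ⟩
      q □ ∏ (filter (∂≡? d) (factors b))     ≡⟨ cong (λ xs → q □ ∏ xs) (filter-none (∂≡? d) others) ⟩
      q □ e□                                 ≡⟨ □-identityʳ (addPrime⇒≢e₊ (mulPrime-addPrime q mq)) ⟩
      q                                      ∎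
    other-factors : ∏ (filter (∁? (∂≡? d)) (factors (q □ b))) ≡ b
    other-factors = begin
      ∏ (filter (∁? (∂≡? d)) (factors (q □ b)))  ≡⟨ ∏-↭ (filter-↭ (∁? (∂≡? d)) factors↭) ⟩
      ∏ (filter (∁? (∂≡? d)) (q ∷ factors b))    ≡⟨ cong ∏ (filter-reject (∁? (∂≡? d)) (λ ∂q≢d → ∂q≢d ∂q≡d)) ⟩
      ∏ (filter (∁? (∂≡? d)) (factors b))        ≡⟨ cong ∏ (filter-all (∁? (∂≡? d)) others) ⟩
      ∏ (factors b)                              ≡⟨ ∏-factors ab ⟩
      b                                          ∎

  □-¬mulPrime : ∀ {q b} → IsMulPrime q → IsAddPrime b → b ≢ e□ → ¬ IsMulPrime (q □ b)
  □-¬mulPrime {q} {b} mq ab b≢e□ mq□b = go (factors b) (factors-mulPrime ab) (∏-factors ab)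
    where
    go : ∀ xs → All IsMulPrime xs → ∏ xs ≡ b → ⊥
    go []       _   ∏≡b = b≢e□ (sym ∏≡b)
    go (x ∷ xs) mxs ∏≡b = contradiction (↭-length two-factorisations) λ ()
      where
      two-factorisations : [ q □ b ] ↭ q ∷ x ∷ xs
      two-factorisations = mulFree-unique _ _ (mq□b ∷ []) (mq ∷ mxs)
        (trans (□-identityʳ (addPrime⇒≢e₊ (mulPrime-addPrime _ mq□b))) (cong (q □_) (sym ∏≡b)))

  □-∈-composites : ∀ {q b d k} → IsMulPrime q → ∂ q ≡ d → IsAddPrime b → ∂ b ≡ k → 2 ≤ k →
                   q □ b ∈ composites (d * k)
  □-∈-composites {q} {b} mq ∂q≡d ab ∂b≡k 2≤k =
    ∈-filter⁺ (∁? mulPrime?) (∈-addPrimes⁺ (addPrime-□ q b (mulPrime-addPrime q mq) ab) (trans (∂-□ q b) (cong₂ _*_ ∂q≡d ∂b≡k)))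
              (□-¬mulPrime mq ab (2≤∂⇒≢e□ (subst (2 ≤_) (sym ∂b≡k) 2≤k)))

  composite⇒□-of-large : ∀ {o a} → IsAddPrime a → ¬ IsMulPrime a → a ≢ e□ → All (λ x → o ≤ ∂ x) (factors a) →
    ∃₂ λ q b → IsAddPrime q × IsAddPrime b × o ≤ ∂ q × o ≤ ∂ b × q □ b ≡ a
  composite⇒□-of-large {o} {a} ap ¬ma a≢e□ large = go (factors a) (factors-mulPrime ap) (∏-factors ap) large
    where
    go : ∀ xs → All IsMulPrime xs → ∏ xs ≡ a → All (λ x → o ≤ ∂ x) xs →
         ∃₂ λ q b → IsAddPrime q × IsAddPrime b × o ≤ ∂ q × o ≤ ∂ b × q □ b ≡ a
    go []           _                 ∏≡a _ = contradiction (sym ∏≡a) a≢e□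
    go (q ∷ [])     (mq ∷ [])         ∏≡a _ =
      contradiction (subst IsMulPrime (trans (sym (□-identityʳ (addPrime⇒≢e₊ (mulPrime-addPrime q mq)))) ∏≡a) mq) ¬ma
    go (q ∷ r ∷ rs) (mq ∷ mr ∷ mrs) ∏≡a (o≤∂q ∷ o≤∂r ∷ _) =
      q , r □ ∏ rs , mulPrime-addPrime q mq , addPrime-∏ (mulPrimes⇒addPrimes (mr ∷ mrs)) , o≤∂q , o≤∂b , ∏≡a
      where
      0<∂rs = addPrime⇒0<∂ (addPrime-∏ (mulPrimes⇒addPrimes mrs))
      o≤∂b : o ≤ ∂ (r □ ∏ rs)
      o≤∂b = ≤-trans o≤∂r (subst (∂ r ≤_) (sym (∂-□ r (∏ rs))) (m≤m*n (∂ r) (∂ (∏ rs)) {{>-nonZero 0<∂rs}}))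

  □-∈-collapse-image : ∀ {q b} o .{{_ : NonZero o}} → 2 ≤ o → IsAddPrime q → IsAddPrime b → o ≤ ∂ q → o ≤ ∂ b →
    q □ b ∈ map collapse (fibre (∂ (q □ b) / o + o))
  □-∈-collapse-image {q} {b} o 2≤o aq ab o≤∂q o≤∂b =
    subst (_∈ map collapse (fibre target)) collapse≡ (∈-map⁺ collapse (∈-fibre⁺ ∂padded))
    where
    target = ∂ (q □ b) / o + o
    ∂q+∂b≤ : ∂ q + ∂ b ≤ target
    ∂q+∂b≤ = subst (λ n → ∂ q + ∂ b ≤ n / o + o) (sym (∂-□ q b)) (m+n≤m*n/o+o o o≤∂q o≤∂b)
    j = target ∸ (∂ q + ∂ b)
    ∂padded : ∂ (padded (q ∷ b ∷ []) j) ≡ target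
    ∂padded = trans (∂-padded (q ∷ b ∷ []) j)
                    (trans (cong (λ n → ∂ q + n + j) (+-identityʳ (∂ b))) (m+[n∸m]≡n ∂q+∂b≤))
    ∂≢1 : ∀ {x} → o ≤ ∂ x → ∂ x ≢ 1
    ∂≢1 o≤∂x ∂x≡1 = <⇒≱ (≤-trans 2≤o o≤∂x) (≤-reflexive ∂x≡1)
    collapse≡ : collapse (padded (q ∷ b ∷ []) j) ≡ q □ b
    collapse≡ = trans (collapse-padded j (aq ∷ ab ∷ []) (∂≢1 o≤∂q ∷ ∂≢1 o≤∂b ∷ []))
                      (cong (q □_) (□-identityʳ (addPrime⇒≢e₊ ab)))

  S⁺-S□≡composites : ∀ n → ℤ.+ (S⁺ n) ℤ.- ℤ.+ (S□ n) ≡ ℤ.+ (length (composites n))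
  S⁺-S□≡composites n rewrite S⁺≡S□+composites n =
    trans (+m-+n≡+[m∸n] (m≤m+n (S□ n) _)) (cong ℤ.+_ (m+n∸m≡n (S□ n) _))

module LeastMulPrimeDegree (𝕊 : ArithSemiring) (p′ : ℕ) (least : IsLeastMulPrimeDegree 𝕊 (suc p′)) where
  open ArithSemiring 𝕊
  open Properties 𝕊

  p : ℕ
  p = suc p′

  2≤p : 2 ≤ p
  2≤p = ≮⇒≥ (proj₁ least ∘ S□[<2]≡0)

  mulPrime⇒p≤∂ : ∀ {x} → IsMulPrime x → p ≤ ∂ x
  mulPrime⇒p≤∂ {x} mx = ≮⇒≥ λ ∂x<p → <⇒≢ (∈⇒0<length (∈-mulPrimes⁺ mx refl)) (sym (proj₂ least (∂ x) ∂x<p))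

  p*2≡p+p : p * 2 ≡ p + p
  p*2≡p+p = trans (*-comm p 2) (cong (p +_) (+-identityʳ p))

  1+p≤p*p : suc p ≤ p * p
  1+p≤p*p = begin
    1 + p    ≤⟨ +-monoˡ-≤ p (≤-trans (s≤s z≤n) 2≤p) ⟩
    p + p    ≡⟨ p*2≡p+p ⟨
    p * 2    ≤⟨ *-monoʳ-≤ p 2≤p ⟩
    p * p    ∎
    where open ≤-Reasoning

  errorDegree : ℕ → ℕ
  errorDegree n = n / suc p + p + 1

  errorDegree≡ : ∀ n → errorDegree n ≡ n / suc p + suc p
  errorDegree≡ n = trans (+-assoc (n / suc p) p 1) (cong (n / suc p +_) (+-comm p 1))

  errorDegree→∞ : ∀ M → Eventually (λ n → M ≤ errorDegree n)
  errorDegree→∞ M = suc p * M , λ n [1+p]M≤n → begin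
    M                  ≡⟨ m*n/n≡m M (suc p) ⟨
    M * suc p / suc p  ≤⟨ /-monoˡ-≤ (suc p) (subst (_≤ n) (*-comm (suc p) M) [1+p]M≤n) ⟩
    n / suc p          ≤⟨ m≤m+n (n / suc p) (p + 1) ⟩
    n / suc p + (p + 1) ≡⟨ +-assoc (n / suc p) p 1 ⟨
    errorDegree n      ∎
    where open ≤-Reasoning

  errorDegree<n : ∀ {n} → suc p * suc p < n → errorDegree n < n
  errorDegree<n {n} [1+p]²<n = subst (_< n) (sym (errorDegree≡ n)) (*-cancelˡ-< (suc p) _ n (begin-strict
    suc p * (n / suc p + suc p)          ≡⟨ *-distribˡ-+ (suc p) (n / suc p) (suc p) ⟩
    suc p * (n / suc p) + suc p * suc p  ≤⟨ +-monoˡ-≤ (suc p * suc p) (subst (_≤ n) (*-comm (n / suc p) (suc p)) (m/n*n≤m n (suc p))) ⟩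
    n + suc p * suc p                    <⟨ +-monoʳ-< n (≤-trans [1+p]²<n (m≤n*m n p {{>-nonZero (≤-trans (s≤s z≤n) 2≤p)}})) ⟩
    n + p * n                            ≡⟨⟩
    suc p * n                            ∎))
    where open ≤-Reasoning

  factors-above-p : ∀ {a} → IsAddPrime a → ¬ HasFactorOfDegree p a → All (λ x → suc p ≤ ∂ x) (factors a)
  factors-above-p {a} ap ¬hasFactor =
    All.zipWith (λ (mx , ∂x≢p) → ≤∧≢⇒< (mulPrime⇒p≤∂ mx) (∂x≢p ∘ sym)) (factors-mulPrime ap , ¬Any⇒All¬ (factors a) ¬hasFactor)

  composite⇒∈collapse-image : ∀ {a n} → 2 ≤ n → a ∈ composites n → ¬ HasFactorOfDegree p a →
                              a ∈ map collapse (fibre (errorDegree n))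
  composite⇒∈collapse-image 2≤n a∈ ¬hasFactor with ∈-composites⁻ a∈
  ... | ap , ¬ma , refl with composite⇒□-of-large ap ¬ma (2≤∂⇒≢e□ 2≤n) (factors-above-p ap ¬hasFactor)
  ... | q , b , aq , ab , ∂q>p , ∂b>p , refl =
    subst (λ m → q □ b ∈ map collapse (fibre m)) (sym (errorDegree≡ (∂ (q □ b))))
          (□-∈-collapse-image (suc p) (m≤n⇒m≤1+n 2≤p) aq ab ∂q>p ∂b>p)

  composites-≤ : ∀ {n} → 2 ≤ n → length (composites n) ≤ S□ p * atQuotient S⁺ n p + S (errorDegree n)
  composites-≤ {n} 2≤n = begin
    length (composites n)                                 ≡⟨ length-filter-∁ (hasFactorOfDegree? p) (composites n) ⟨
    length withFactor + length withoutFactor              ≤⟨ +-mono-≤ withFactor-≤ withoutFactor-≤ ⟩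
    S□ p * atQuotient S⁺ n p + S (errorDegree n)          ∎
    where
    open ≤-Reasoning
    withFactor withoutFactor : List Carrier
    withFactor    = filter (hasFactorOfDegree? p) (composites n)
    withoutFactor = filter (∁? (hasFactorOfDegree? p)) (composites n)
    withFactor-≤ : length withFactor ≤ S□ p * atQuotient S⁺ n p
    withFactor-≤ = length-≤-hasFactorOfDegree p′ n (Unique.filter⁺ _ (Unique-composites n)) λ a∈ →
      let a∈composites , hasFactor = ∈-filter⁻ (hasFactorOfDegree? p) {xs = composites n} a∈
      in proj₁ (∈-filter⁻ (∁? mulPrime?) {xs = addPrimes n} a∈composites) , hasFactor
    withoutFactor-≤ : length withoutFactor ≤ S (errorDegree n)
    withoutFactor-≤ = Unique⇒length-≤-map collapse (Unique.filter⁺ _ (Unique-composites n)) λ a∈ →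
      let a∈composites , ¬hasFactor = ∈-filter⁻ (∁? (hasFactorOfDegree? p)) {xs = composites n} a∈
      in composite⇒∈collapse-image 2≤n a∈composites ¬hasFactor

  composites-≥ : ∀ {k} → 2 ≤ k →
    S□ p * S⁺ k ≤ length (composites (p * k)) + S□ p * (S□ p * atQuotient S⁺ k p)
  composites-≥ {k} 2≤k = begin
    S□ p * S⁺ k                                          ≡⟨ cong (S□ p *_) (length-filter-∁ (hasFactorOfDegree? p) (addPrimes k)) ⟨
    S□ p * (length withFactor + length withoutFactor)   ≡⟨ *-distribˡ-+ (S□ p) (length withFactor) _ ⟩
    S□ p * length withFactor + S□ p * length withoutFactor
                                                         ≡⟨ +-comm (S□ p * length withFactor) _ ⟩
    S□ p * length withoutFactor + S□ p * length withFactor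
                                                         ≤⟨ +-mono-≤ withoutFactor-≤ (*-monoʳ-≤ (S□ p) withFactor-≤) ⟩
    length (composites (p * k)) + S□ p * (S□ p * atQuotient S⁺ k p) ∎
    where
    open ≤-Reasoning
    withFactor withoutFactor : List Carrier
    withFactor    = filter (hasFactorOfDegree? p) (addPrimes k)
    withoutFactor = filter (∁? (hasFactorOfDegree? p)) (addPrimes k)
    withFactor-≤ : length withFactor ≤ S□ p * atQuotient S⁺ k p
    withFactor-≤ = length-≤-hasFactorOfDegree p′ k (Unique.filter⁺ _ (Unique-addPrimes k))
                                              (∈-filter⁻ (hasFactorOfDegree? p) {xs = addPrimes k})
    ⊆split : cartesianProduct (mulPrimes p) withoutFactor ⊆ map (split p) (composites (p * k))
    ⊆split {q , b} qb∈ with ∈-cartesianProduct⁻ (mulPrimes p) withoutFactor qb∈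
    ... | q∈ , b∈ with ∈-mulPrimes⁻ q∈ | ∈-filter⁻ (∁? (hasFactorOfDegree? p)) {xs = addPrimes k} b∈
    ... | mq , ∂q≡p | b∈addPrimes , ¬hasFactor with ∈-addPrimes⁻ b∈addPrimes
    ... | ab , ∂b≡k = subst (_∈ map (split p) (composites (p * k))) (split-□ mq ∂q≡p ab ¬hasFactor)
                            (∈-map⁺ (split p) (□-∈-composites mq ∂q≡p ab ∂b≡k 2≤k))
    withoutFactor-≤ : S□ p * length withoutFactor ≤ length (composites (p * k))
    withoutFactor-≤ = begin
      S□ p * length withoutFactor                         ≡⟨ length-cartesianProduct (mulPrimes p) withoutFactor ⟨
      length (cartesianProduct (mulPrimes p) withoutFactor) ≤⟨ Unique⇒length-≤-map (split p)
        (Unique.cartesianProduct⁺ (Unique-mulPrimes p) (Unique.filter⁺ _ (Unique-addPrimes k))) ⊆split ⟩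
      length (composites (p * k))                         ∎

  S□*atQuotient-≤ : ∀ {n} → p + p ≤ n →
    S□ p * atQuotient S⁺ n p ≤ length (composites n) + S□ p * (S□ p * S (errorDegree n))
  S□*atQuotient-≤ {n} 2p≤n = by-divisibility (p ∣? n)
    where
    open ≤-Reasoning
    k = n / p
    atQuotient-≤-S : atQuotient S⁺ k p ≤ S (errorDegree n)
    atQuotient-≤-S = atQuotient-≤ S⁺ k p′ λ _ → S⁺-≤-S (begin
      k / p               ≡⟨ m/n/o≡m/[n*o] n p p ⟩
      n / (p * p)         ≤⟨ /-monoʳ-≤ n 1+p≤p*p ⟩
      n / suc p           ≤⟨ m≤m+n (n / suc p) (p + 1) ⟩
      n / suc p + (p + 1) ≡⟨ +-assoc (n / suc p) p 1 ⟨
      errorDegree n       ∎)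
    by-divisibility : Dec (p ∣ n) →
      S□ p * atQuotient S⁺ n p ≤ length (composites n) + S□ p * (S□ p * S (errorDegree n))
    by-divisibility (no p∤n) = begin
      S□ p * atQuotient S⁺ n p   ≡⟨ cong (S□ p *_) (atQuotient-∤ S⁺ n p′ p∤n) ⟩
      S□ p * 0                   ≡⟨ *-zeroʳ (S□ p) ⟩
      0                          ≤⟨ z≤n ⟩
      length (composites n) + S□ p * (S□ p * S (errorDegree n)) ∎
    by-divisibility (yes p∣n) = begin
      S□ p * atQuotient S⁺ n p                                         ≡⟨ cong (S□ p *_) (atQuotient-∣ S⁺ n p′ p∣n) ⟩
      S□ p * S⁺ k                                                      ≤⟨ composites-≥ 2≤k ⟩
      length (composites (p * k)) + S□ p * (S□ p * atQuotient S⁺ k p)  ≤⟨ +-mono-≤ (≤-reflexive (cong (length ∘ composites) p*k≡n))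
                                                                            (*-monoʳ-≤ (S□ p) (*-monoʳ-≤ (S□ p) atQuotient-≤-S)) ⟩
      length (composites n) + S□ p * (S□ p * S (errorDegree n))        ∎
      where
      p*k≡n : p * k ≡ n
      p*k≡n = m*[n/m]≡n p∣n
      2≤k : 2 ≤ k
      2≤k = *-cancelˡ-≤ p (subst₂ _≤_ (sym p*2≡p+p) (sym p*k≡n) 2p≤n)

  mainEstimate : MainEstimate 𝕊 p
  mainEstimate = suc (S□ p * S□ p) , p + p , λ n 2p≤n → begin
    ℤ.∣ ℤ.+ (S⁺ n) ℤ.- ℤ.+ (S□ n) ℤ.- ℤ.+ (S□ p * atQuotient S⁺ n p) ∣
      ≡⟨ cong (λ z → ℤ.∣ z ℤ.- ℤ.+ (S□ p * atQuotient S⁺ n p) ∣) (S⁺-S□≡composites n) ⟩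
    ℤ.∣ ℤ.+ (length (composites n)) ℤ.- ℤ.+ (S□ p * atQuotient S⁺ n p) ∣
      ≤⟨ ∣+m-+n∣≤x+y (composites-≤ (≤-trans 2≤p (≤-trans (m≤m+n p p) 2p≤n))) (S□*atQuotient-≤ 2p≤n) ⟩
    S (errorDegree n) + S□ p * (S□ p * S (errorDegree n))
      ≡⟨ cong (S (errorDegree n) +_) (*-assoc (S□ p) (S□ p) _) ⟨
    suc (S□ p * S□ p) * S (errorDegree n)
      ∎
    where open ≤-Reasoning

  composites-≤-nonAddPrimes : ∀ {n} → suc p * suc p < n → S (errorDegree n) ≤ 2 * S⁺ (errorDegree n) →
    length (composites n) ≤ (S□ p + 2) * (S n ∸ S⁺ n)
  composites-≤-nonAddPrimes {n} [1+p]²<n S≤2S⁺ = begin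
    length (composites n)                         ≤⟨ composites-≤ 2≤n ⟩
    S□ p * atQuotient S⁺ n p + S (errorDegree n)  ≤⟨ +-mono-≤ (*-monoʳ-≤ (S□ p) atQuotient-≤-S∸S⁺) S-≤-S∸S⁺ ⟩
    S□ p * (S n ∸ S⁺ n) + 2 * (S n ∸ S⁺ n)        ≡⟨ *-distribʳ-+ (S n ∸ S⁺ n) (S□ p) 2 ⟨
    (S□ p + 2) * (S n ∸ S⁺ n)                     ∎
    where
    open ≤-Reasoning
    2≤n : 2 ≤ n
    2≤n = ≤-trans (m≤n⇒m≤1+n 2≤p) (≤-trans (m≤m*n (suc p) (suc p)) (<⇒≤ [1+p]²<n))
    atQuotient-≤-S∸S⁺ : atQuotient S⁺ n p ≤ S n ∸ S⁺ n
    atQuotient-≤-S∸S⁺ = atQuotient-≤ S⁺ n p′ λ _ → S⁺-≤-S∸S⁺ (m/n<m n p {{>-nonZero (≤-trans (s≤s z≤n) 2≤n)}} 2≤p)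
    S-≤-S∸S⁺ : S (errorDegree n) ≤ 2 * (S n ∸ S⁺ n)
    S-≤-S∸S⁺ = ≤-trans S≤2S⁺ (*-monoʳ-≤ 2 (S⁺-≤-S∸S⁺ (errorDegree<n [1+p]²<n)))

  G₁⁺⇒G₁□ : G₁⁺ 𝕊 → G₁□ 𝕊
  G₁⁺⇒G₁□ S∼S⁺ k = eventually-map bound
    (eventually-× (eventually-× (eventually-≥ (suc (suc p * suc p))) (eventually-∘ errorDegree errorDegree→∞ S≤2S⁺))
                  (eventually-× (nonAddPrimes-small K) S≤2S⁺))
    where
    K = 2 * (suc k * (S□ p + 2))
    nonAddPrimes-small : ∀ K → Eventually (λ n → suc K * (S n ∸ S⁺ n) ≤ S n)
    nonAddPrimes-small K = eventually-map (λ {n} → subst (λ d → suc K * d ≤ S n) (cong ℤ.∣_∣ (+m-+n≡+[m∸n] (S⁺≤S n)))) (S∼S⁺ K)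
    S≤2S⁺ : Eventually (λ n → S n ≤ 2 * S⁺ n)
    S≤2S⁺ = eventually-map (λ {n} → 2*[m∸n]≤m⇒m≤2*n {S n} {S⁺ n}) (nonAddPrimes-small 1)
    bound : ∀ {n} → (suc p * suc p < n × S (errorDegree n) ≤ 2 * S⁺ (errorDegree n)) ×
                    (suc K * (S n ∸ S⁺ n) ≤ S n × S n ≤ 2 * S⁺ n) →
                    suc k * ℤ.∣ ℤ.+ (S⁺ n) ℤ.- ℤ.+ (S□ n) ∣ ≤ S⁺ n
    bound {n} (([1+p]²<n , S≤2S⁺[errorDegree]) , (small , S≤2S⁺[n])) rewrite S⁺-S□≡composites n = *-cancelˡ-≤ 2 (begin
      2 * (suc k * length (composites n))   ≤⟨ *-monoʳ-≤ 2 (*-monoʳ-≤ (suc k) (composites-≤-nonAddPrimes [1+p]²<n S≤2S⁺[errorDegree])) ⟩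
      2 * (suc k * ((S□ p + 2) * B))        ≡⟨ cong (2 *_) (*-assoc (suc k) (S□ p + 2) B) ⟨
      2 * (suc k * (S□ p + 2) * B)          ≡⟨ *-assoc 2 (suc k * (S□ p + 2)) B ⟨
      K * B                                 ≤⟨ m≤n+m (K * B) B ⟩
      suc K * B                             ≤⟨ small ⟩
      S n                                   ≤⟨ S≤2S⁺[n] ⟩
      2 * S⁺ n                              ∎)
      where
      open ≤-Reasoning
      B = S n ∸ S⁺ n

theorem3p15 : (𝕊 : ArithSemiring) → Monotonic 𝕊 → (p : ℕ) → IsLeastMulPrimeDegree 𝕊 p →
    MainEstimate 𝕊 p × (G₁⁺ 𝕊 → G₁□ 𝕊)
theorem3p15 𝕊 _ zero     (S□0≢0 , _) = contradiction (Properties.S□[<2]≡0 𝕊 (s≤s z≤n)) S□0≢0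
theorem3p15 𝕊 _ (suc p′) least        = mainEstimate , G₁⁺⇒G₁□
  where open LeastMulPrimeDegree 𝕊 p′ least
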